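{- Let $L=(\ell_{i,j})$ be a Latin square of order $n$, let $L_3(L,n)$ be its Latin square graph, and let $S$ be a subset of the vertex set of $L_3(L,n)$. Then the following statements are equivalent: (i) $S$ is a $3$-dominating set of $L_3(L,n)$ with cardinality $n$; (ii) $S$ is a $(1,3)$-independent dominating set of $L_3(L,n)$ with cardinality $n$; (iii) the entries $\{\ell_{i,j}\mid (i,j)\in S\}$ of $L$ in the cells of $S$ form a transversal in $L$.
   Context: A Latin square of order $n$ is an $n\times n$ array $L=(\ell_{i,j})$ with entries from $[n]=\{1,\dots,n\}$ such that no symbol appears twice in any row or column. A transversal in $L$ is a set of $n$ cells (entries) containing exactly one cell from each row, exactly one from each column, and exactly one cell of each symbol. The Latin square graph $L_3(L,n)$ has vertex set $\{(i,j)\mid 1\le i,j\le n\}$, and two distinct vertices $(i,j)$ and $(p,q)$ are adjacent iff $i=p$ or $j=q$ or $\ell_{i,j}=\ell_{p,q}$. A subset $S$ of the vertex set $V$ of a graph is $k$-dominating if every vertex in $V\setminus S$ has at least $k$ neighbours in $S$. A $(1,3)$-independent dominating set is a $3$-dominating set $S$ that is independent (the subgraph induced by $S$ has no edges, i.e. its maximum degree is at most $0$). -}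

module Defs where

open import Data.Nat using (ℕ; _≤_)
open import Data.Fin using (Fin)
open import Data.Fin.Properties using (_≟_)
open import Data.Bool using (Bool; true; false; T; if_then_else_)
open import Data.Product using (_×_; _,_; ∃; proj₁; proj₂)
open import Data.Sum using (_⊎_; inj₁; inj₂)
open import Data.List using (List; length; filter; allFin; cartesianProduct)
open import Relation.Nullary using (¬_; Dec; yes; no)
open import Relation.Nullary.Decidable using (_×-dec_)
import Data.Bool as B
open import Relation.Binary.PropositionalEquality using (_≡_; _≢_; refl; cong)
open import Function.Definitions using (Injective)
open import Relation.Unary using (Pred; Decidable)

-- Symbols, rows and columns are indexed by Fin n (i.e. [n] shifted to 0..n-1).

record LatinSquare (n : ℕ) : Set where
  field
    entry    : Fin n → Fin n → Fin n
    rowInj   : ∀ i → Injective _≡_ _≡_ (entry i)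
    colInj   : ∀ j → Injective _≡_ _≡_ (λ i → entry i j)
open LatinSquare public

Cell : ℕ → Set
Cell n = Fin n × Fin n

-- all n² cells (vertices of L₃(L,n)), each listed once
cells : (n : ℕ) → List (Cell n)
cells n = cartesianProduct (allFin n) (allFin n)

VSubset : ℕ → Set
VSubset n = Cell n → Bool

_∈S_ : ∀ {n} → Cell n → VSubset n → Set
c ∈S S = T (S c)

card : ∀ {n} → VSubset n → ℕ
card {n} S = length (filter (λ c → S c B.≟ true) (cells n))

Adj : ∀ {n} → LatinSquare n → Cell n → Cell n → Set
Adj L (i , j) (p , q) =
  (i , j) ≢ (p , q) × (i ≡ p ⊎ j ≡ q ⊎ entry L i j ≡ entry L p q)

adj? : ∀ {n} (L : LatinSquare n) (u v : Cell n) → Dec (Adj L u v)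
adj? L (i , j) (p , q) with i ≟ p | j ≟ q
... | yes refl | yes refl = no (λ x → proj₁ x refl)
... | yes refl | no j≢q = yes ((λ e → j≢q (cong proj₂ e)) , inj₁ refl)
... | no i≢p | b with j ≟ q
...   | yes e = yes ((λ e' → i≢p (cong proj₁ e')) , inj₂ (inj₁ e))
...   | no j≢q with entry L i j ≟ entry L p q
...     | yes e = yes ((λ e' → i≢p (cong proj₁ e')) , inj₂ (inj₂ e))
...     | no s≢ = no (λ { (_ , inj₁ e) → i≢p e
                        ; (_ , inj₂ (inj₁ e)) → j≢q e
                        ; (_ , inj₂ (inj₂ e)) → s≢ e })

nbrsIn : ∀ {n} → LatinSquare n → VSubset n → Cell n → ℕ
nbrsIn {n} L S v =
  length (filter (λ c → (S c B.≟ true) ×-dec adj? L v c) (cells n))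

KDominating : ∀ {n} → ℕ → LatinSquare n → VSubset n → Set
KDominating k L S = ∀ v → ¬ (v ∈S S) → k ≤ nbrsIn L S v

Independent : ∀ {n} → LatinSquare n → VSubset n → Set
Independent L S = ∀ u v → u ∈S S → v ∈S S → ¬ Adj L u v

IndepDominating13 : ∀ {n} → LatinSquare n → VSubset n → Set
IndepDominating13 L S = KDominating 3 L S × Independent L S

ExactlyOne : ∀ {n} → VSubset n → (Cell n → Set) → Set
ExactlyOne S P = ∃ λ c → (c ∈S S × P c) × (∀ d → d ∈S S → P d → d ≡ c)

Transversal : ∀ {n} → LatinSquare n → VSubset n → Set
Transversal {n} L S =
  (∀ (r : Fin n) → ExactlyOne S (λ c → proj₁ c ≡ r)) ×
  (∀ (k : Fin n) → ExactlyOne S (λ c → proj₂ c ≡ k)) ×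
  (∀ (s : Fin n) → ExactlyOne S (λ c → entry L (proj₁ c) (proj₂ c) ≡ s))

module Submission where

-- Every cell has three coordinates (row, column, symbol), any two of which
-- determine it, and two distinct cells are adjacent iff they share one.  A
-- transversal is a set meeting every class (a = t) of every axis a exactly once.
--   (iii) ⇒ (ii): two cells of S sharing a coordinate represent the same class;
--     a cell v ∉ S sees the three distinct representatives of its classes.
--   (ii) ⇒ (i) is trivial.
--   (i) ⇒ (iii) by double counting: the classes of an axis partition S, so their
--     sizes sum to n; v has at most ∑ₐ |S ∩ class of v on axis a| neighbours in S.
--     If some class a = t missed S, its n cells would need 3n neighbours in S,
--     but the other two axes' classes met along that line hold at most 2n.
--     So all n class sizes are positive with sum n, hence all equal to 1.
-- The file first develops finite sums of naturals and counting, then the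
-- axis structure of a Latin square, then the three implications.

open import Defs

open import Data.Nat using (ℕ; zero; suc; _+_; _*_; _∸_; _≤_; _<_; z≤n; s≤s; _<?_)
open import Data.Nat.Properties
  using ( +-0-commutativeMonoid; ≤-trans; ≤-reflexive; ≤-antisym; <-irrefl; ≮⇒≥; n≤0⇒n≡0
        ; 1+n≰n; m≤m+n; m≤n+m; +-comm; +-identityʳ; +-mono-≤; +-monoʳ-≤; +-cancelʳ-≤
        ; *-comm; *-identityʳ; *-cancelˡ-≤; m∸n+n≡m; module ≤-Reasoning )
open import Data.Fin using (Fin; zero; suc; punchIn; punchOut)
open import Data.Fin.Properties
  using ( _≟_; nonZeroIndex; injective⇒≤; any?; suc-injective
        ; punchIn-punchOut; punchInᵢ≢i; punchOut-injective )
open import Data.Bool using (true; false; T; if_then_else_)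
import Data.Bool as B
open import Data.Bool.Properties using (T-≡)
open import Data.Product using (_×_; _,_; ∃; proj₁; proj₂)
open import Data.Product.Properties using (≡-dec)
open import Data.Sum using (inj₁; inj₂)
open import Data.List using (List; []; _∷_; _++_; length; map; filter; tabulate; cartesianProduct)
open import Data.List.Properties using (length-++; filter-++; map-tabulate)
open import Data.List.Relation.Unary.All as All using (All; []; _∷_)
open import Data.List.Relation.Unary.AllPairs using ([]; _∷_)
open import Data.List.Relation.Unary.Unique.Propositional using (Unique)
open import Data.Vec.Functional using (removeAt)
open import Function.Base using (_∘_; id)
open import Function.Bundles using (Equivalence; _⇔_; mk⇔)
open import Function.Definitions using (Injective)
open import Relation.Binary.PropositionalEquality
open import Relation.Nullary using (Dec; does; yes; no; ¬_; contradiction)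
open import Relation.Nullary.Decidable using (_×-dec_)
open import Relation.Unary using (Pred; Decidable)

open import Algebra.Properties.CommutativeMonoid.Sum +-0-commutativeMonoid
  using (sum; sum-syntax; sum-cong-≗; sum-replicate-zero; sum-remove; ∑-distrib-+; ∑-comm)

∑-mono : ∀ {n} {f g : Fin n → ℕ} → (∀ i → f i ≤ g i) → sum f ≤ sum g
∑-mono {zero}  f≤g = z≤n
∑-mono {suc n} f≤g = +-mono-≤ (f≤g zero) (∑-mono (f≤g ∘ suc))

∑-const : ∀ n c → ∑[ i < n ] c ≡ n * c
∑-const zero    c = refl
∑-const (suc n) c = cong (c +_) (∑-const n c)

∑-zero : ∀ {n} (f : Fin n → ℕ) → (∀ i → f i ≡ 0) → sum f ≡ 0
∑-zero {n} f f≡0 = trans (sum-cong-≗ f≡0) (sum-replicate-zero n)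

∑-point : ∀ {n} (f : Fin n → ℕ) (x : Fin n) → (∀ i → i ≢ x → f i ≡ 0) → sum f ≡ f x
∑-point {suc n} f x off = begin
  sum f                    ≡⟨ sum-remove f ⟩
  f x + sum (removeAt f x) ≡⟨ cong (f x +_) (∑-zero _ (λ j → off (punchIn x j) (punchInᵢ≢i x j))) ⟩
  f x + 0                  ≡⟨ +-identityʳ (f x) ⟩
  f x                      ∎
  where open ≡-Reasoning

∑-witness : ∀ {n} (f : Fin n → ℕ) → 0 < sum f → ∃ λ i → 0 < f i
∑-witness f 0<∑f with any? (λ i → 0 <? f i)
... | yes witness = witness
... | no none = contradiction (subst (0 <_) ∑f≡0 0<∑f) (<-irrefl refl)
  where
  ∑f≡0 : sum f ≡ 0
  ∑f≡0 = ∑-zero f (λ i → n≤0⇒n≡0 (≮⇒≥ (λ 0<fi → none (i , 0<fi))))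

∑-tight : ∀ {n} (f : Fin n → ℕ) → (∀ i → 1 ≤ f i) → sum f ≤ n → ∀ i → f i ≤ 1
∑-tight {suc n} f 1≤f ∑f≤n i = +-cancelʳ-≤ n (f i) 1 (begin
  f i + n                     ≡⟨ cong (f i +_) (sym (trans (∑-const n 1) (*-identityʳ n))) ⟩
  f i + ∑[ j < n ] 1          ≤⟨ +-monoʳ-≤ (f i) (∑-mono (1≤f ∘ punchIn i)) ⟩
  f i + sum (removeAt f i)    ≡⟨ sum-remove f ⟨
  sum f                       ≤⟨ ∑f≤n ⟩
  suc n                       ∎)
  where open ≤-Reasoning

∑-reindex-≤ : ∀ {m n} (f : Fin n → ℕ) {g : Fin m → Fin n} → Injective _≡_ _≡_ g →
              sum (f ∘ g) ≤ sum f
∑-reindex-≤ {zero}          f     g-inj = z≤n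
∑-reindex-≤ {suc m} {zero}  f {g} g-inj with g zero
... | ()
∑-reindex-≤ {suc m} {suc n} f {g} g-inj = begin
  f (g zero) + sum (f ∘ g ∘ suc)
    ≡⟨ cong (f (g zero) +_) (sum-cong-≗ (λ i → cong f (sym (punchIn-punchOut (g₀≢ i))))) ⟩
  f (g zero) + sum (removeAt f (g zero) ∘ h)
    ≤⟨ +-monoʳ-≤ (f (g zero)) (∑-reindex-≤ (removeAt f (g zero)) h-inj) ⟩
  f (g zero) + sum (removeAt f (g zero))
    ≡⟨ sum-remove f ⟨
  sum f
    ∎
  where
  open ≤-Reasoning
  -- the remaining indices g (suc i) avoid g zero, so they live in Fin n
  g₀≢ : ∀ i → g zero ≢ g (suc i)
  g₀≢ i e = 0≢suc (g-inj e)
    where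
    0≢suc : zero ≢ suc i
    0≢suc ()
  h : Fin m → Fin n
  h i = punchOut (g₀≢ i)
  h-inj : Injective _≡_ _≡_ h
  h-inj e = suc-injective (g-inj (punchOut-injective (g₀≢ _) (g₀≢ _) e))

injective⇒surjective : ∀ {n} {f : Fin n → Fin n} → Injective _≡_ _≡_ f → ∀ t → ∃ λ j → f j ≡ t
injective⇒surjective {suc n} {f} f-inj t with any? (λ j → f j ≟ t)
... | yes hit  = hit
... | no  miss = contradiction (injective⇒≤ h-inj) 1+n≰n
  where
  t≢f : ∀ j → t ≢ f j
  t≢f j e = miss (j , sym e)
  h : Fin (suc n) → Fin n
  h j = punchOut (t≢f j)
  h-inj : Injective _≡_ _≡_ h
  h-inj e = f-inj (punchOut-injective (t≢f _) (t≢f _) e)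

ind : ∀ {p} {P : Set p} → Dec P → ℕ
ind d = if does d then 1 else 0

ind-yes : ∀ {p} {P : Set p} (d : Dec P) → P → ind d ≡ 1
ind-yes (yes _) _ = refl
ind-yes (no ¬p) p = contradiction p ¬p

ind-no : ∀ {p} {P : Set p} (d : Dec P) → ¬ P → ind d ≡ 0
ind-no (yes p) ¬p = contradiction p ¬p
ind-no (no _)  _  = refl

ind-pos : ∀ {p} {P : Set p} (d : Dec P) → P → 0 < ind d
ind-pos d p = ≤-reflexive (sym (ind-yes d p))

ind-pos⁻¹ : ∀ {p} {P : Set p} (d : Dec P) → 0 < ind d → P
ind-pos⁻¹ (yes p) _ = p

ind-≤ : ∀ {p} {P : Set p} (d : Dec P) {k} → (P → 0 < k) → ind d ≤ k
ind-≤ (yes p) 0<k = 0<k p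
ind-≤ (no _)  _   = z≤n

ind-×-yes : ∀ {a b} {A : Set a} {B : Set b} (x : Dec A) (y : Dec B) → B → ind (x ×-dec y) ≡ ind x
ind-×-yes (yes _) (yes _) _ = refl
ind-×-yes (no _)  (yes _) _ = refl
ind-×-yes _       (no ¬b) b = contradiction b ¬b

∑² : ∀ {m n} → (Fin m × Fin n → ℕ) → ℕ
∑² {m} {n} f = ∑[ i < m ] ∑[ j < n ] f (i , j)

∑²-cong : ∀ {m n} {f g : Fin m × Fin n → ℕ} → (∀ c → f c ≡ g c) → ∑² f ≡ ∑² g
∑²-cong f≗g = sum-cong-≗ (λ i → sum-cong-≗ (λ j → f≗g (i , j)))

∑²-mono : ∀ {m n} {f g : Fin m × Fin n → ℕ} → (∀ c → f c ≤ g c) → ∑² f ≤ ∑² g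
∑²-mono f≤g = ∑-mono (λ i → ∑-mono (λ j → f≤g (i , j)))

∑²-distrib-+ : ∀ {m n} (f g : Fin m × Fin n → ℕ) → ∑² (λ c → f c + g c) ≡ ∑² f + ∑² g
∑²-distrib-+ f g = trans (sum-cong-≗ (λ i → ∑-distrib-+ (λ j → f (i , j)) (λ j → g (i , j))))
                         (∑-distrib-+ (λ i → ∑[ j < _ ] f (i , j)) (λ i → ∑[ j < _ ] g (i , j)))

∑²-point : ∀ {m n} (f : Fin m × Fin n → ℕ) (c : Fin m × Fin n) →
           (∀ d → d ≢ c → f d ≡ 0) → ∑² f ≡ f c
∑²-point f (a , b) off = trans
  (∑-point _ a (λ i i≢a → ∑-zero _ (λ j → off (i , j) (i≢a ∘ cong proj₁))))
  (∑-point _ b (λ j j≢b → off (a , j) (j≢b ∘ cong proj₂)))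

∑²-witness : ∀ {m n} (f : Fin m × Fin n → ℕ) → 0 < ∑² f → ∃ λ c → 0 < f c
∑²-witness f 0<∑f with ∑-witness _ 0<∑f
... | i , 0<row with ∑-witness _ 0<row
...   | j , 0<fij = (i , j) , 0<fij

_≟²_ : ∀ {m n} (c d : Fin m × Fin n) → Dec (c ≡ d)
_≟²_ = ≡-dec _≟_ _≟_

∑²-points : ∀ {m n} (f : Fin m × Fin n → ℕ) {cs : List (Fin m × Fin n)} →
            Unique cs → All (λ c → 0 < f c) cs → length cs ≤ ∑² f
∑²-points f [] [] = z≤n
∑²-points f {c ∷ cs} (c≢cs ∷ unique) (0<fc ∷ 0<fcs) = begin
  suc (length cs)        ≡⟨ +-comm 1 (length cs) ⟩
  length cs + 1          ≤⟨ +-mono-≤ (∑²-points f′ unique (All.zipWith positive′ (c≢cs , 0<fcs)))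
                                     (≤-reflexive (sym ∑²δ≡1)) ⟩
  ∑² f′ + ∑² δ           ≡⟨ ∑²-distrib-+ f′ δ ⟨
  ∑² (λ d → f′ d + δ d)  ≡⟨ ∑²-cong (λ d → m∸n+n≡m (δ≤f d)) ⟩
  ∑² f                   ∎
  where
  open ≤-Reasoning
  -- split f into the unit mass δ at c and the rest f′
  δ f′ : Fin _ × Fin _ → ℕ
  δ d = ind (d ≟² c)
  f′ d = f d ∸ δ d
  δ≤f : ∀ d → δ d ≤ f d
  δ≤f d with d ≟² c
  ... | yes refl = 0<fc
  ... | no  _    = z≤n
  ∑²δ≡1 : ∑² δ ≡ 1
  ∑²δ≡1 = trans (∑²-point δ c (λ d → ind-no (d ≟² c))) (ind-yes (c ≟² c) refl)
  positive′ : ∀ {d} → c ≢ d × 0 < f d → 0 < f′ d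
  positive′ {d} (c≢d , 0<fd) = subst (λ k → 0 < f d ∸ k) (sym (ind-no (d ≟² c) (c≢d ∘ sym))) 0<fd

count-tabulate : ∀ {a p} {A : Set a} {P : Pred A p} (P? : Decidable P) {n} (f : Fin n → A) →
                 length (filter P? (tabulate f)) ≡ ∑[ i < n ] ind (P? (f i))
count-tabulate P? {zero}  f = refl
count-tabulate P? {suc n} f with does (P? (f zero))
... | true  = cong suc (count-tabulate P? (f ∘ suc))
... | false = count-tabulate P? (f ∘ suc)

count-grid : ∀ {a b p} {A : Set a} {B : Set b} {P : Pred (A × B) p} (P? : Decidable P)
             {m n} (f : Fin m → A) (g : Fin n → B) →
             length (filter P? (cartesianProduct (tabulate f) (tabulate g)))
               ≡ ∑[ i < m ] ∑[ j < n ] ind (P? (f i , g j))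
count-grid P? {zero}  f g = refl
count-grid P? {suc m} {n} f g = begin
  length (filter P? (row₀ ++ rest))
    ≡⟨ cong length (filter-++ P? row₀ rest) ⟩
  length (filter P? row₀ ++ filter P? rest)
    ≡⟨ length-++ (filter P? row₀) ⟩
  length (filter P? row₀) + length (filter P? rest)
    ≡⟨ cong₂ _+_ (trans (cong (length ∘ filter P?) (map-tabulate g (f zero ,_)))
                        (count-tabulate P? ((f zero ,_) ∘ g)))
                 (count-grid P? (f ∘ suc) g) ⟩
  ∑[ j < n ] ind (P? (f zero , g j)) + ∑[ i < m ] ∑[ j < n ] ind (P? (f (suc i) , g j))
    ∎
  where
  open ≡-Reasoning
  row₀ = map (f zero ,_) (tabulate g)
  rest = cartesianProduct (tabulate (f ∘ suc)) (tabulate g)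

-- The three axes of a Latin square: every cell has a row, a column and a
-- symbol, and the graph L₃(L,n) joins two distinct cells sharing one of them.

data Axis : Set where
  row col symbol : Axis

∑ₐ : (Axis → ℕ) → ℕ
∑ₐ g = g row + g col + g symbol

∑ₐ-term : ∀ a (g : Axis → ℕ) → g a ≤ ∑ₐ g
∑ₐ-term row    g = ≤-trans (m≤m+n (g row) (g col)) (m≤m+n _ (g symbol))
∑ₐ-term col    g = ≤-trans (m≤n+m (g col) (g row)) (m≤m+n _ (g symbol))
∑ₐ-term symbol g = m≤n+m (g symbol) _

∑-∑ₐ : ∀ {m} (f : Axis → Fin m → ℕ) → ∑[ i < m ] ∑ₐ (λ a → f a i) ≡ ∑ₐ (λ a → sum (f a))
∑-∑ₐ f = begin
  ∑[ i < _ ] (f row i + f col i + f symbol i)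
    ≡⟨ ∑-distrib-+ (λ i → f row i + f col i) (f symbol) ⟩
  ∑[ i < _ ] (f row i + f col i) + sum (f symbol)
    ≡⟨ cong (_+ sum (f symbol)) (∑-distrib-+ (f row) (f col)) ⟩
  sum (f row) + sum (f col) + sum (f symbol)
    ∎
  where open ≡-Reasoning

∑²-∑ₐ : ∀ {m n} (f : Axis → Fin m × Fin n → ℕ) → ∑² (λ c → ∑ₐ (λ a → f a c)) ≡ ∑ₐ (λ a → ∑² (f a))
∑²-∑ₐ f = begin
  ∑² (λ c → f row c + f col c + f symbol c)
    ≡⟨ ∑²-distrib-+ (λ c → f row c + f col c) (f symbol) ⟩
  ∑² (λ c → f row c + f col c) + ∑² (f symbol)
    ≡⟨ cong (_+ ∑² (f symbol)) (∑²-distrib-+ (f row) (f col)) ⟩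
  ∑² (f row) + ∑² (f col) + ∑² (f symbol)
    ∎
  where open ≡-Reasoning

∑ₐ-two : ∀ a (g : Axis → ℕ) k → g a ≡ 0 → (∀ b → b ≢ a → g b ≤ k) → ∑ₐ g ≤ 2 * k
∑ₐ-two row    g k g≡0 g≤k rewrite g≡0 | +-identityʳ k =
  +-mono-≤ (g≤k col λ ()) (g≤k symbol λ ())
∑ₐ-two col    g k g≡0 g≤k rewrite g≡0 | +-identityʳ k | +-identityʳ (g row) =
  +-mono-≤ (g≤k row λ ()) (g≤k symbol λ ())
∑ₐ-two symbol g k g≡0 g≤k rewrite g≡0 | +-identityʳ k | +-identityʳ (g row + g col) =
  +-mono-≤ (g≤k row λ ()) (g≤k col λ ())

module Axes {n : ℕ} (L : LatinSquare n) where

  coord : Axis → Cell n → Fin n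
  coord row    c = proj₁ c
  coord col    c = proj₂ c
  coord symbol c = entry L (proj₁ c) (proj₂ c)

  determined : ∀ {a b} → a ≢ b → ∀ {c d} → coord a c ≡ coord a d → coord b c ≡ coord b d → c ≡ d
  determined {row}    {row}    a≢b         _    _    = contradiction refl a≢b
  determined {col}    {col}    a≢b         _    _    = contradiction refl a≢b
  determined {symbol} {symbol} a≢b         _    _    = contradiction refl a≢b
  determined {row}    {col}    _           refl refl = refl
  determined {col}    {row}    _           refl refl = refl
  determined {row}    {symbol} _ {i , _}   refl e    = cong (i ,_) (rowInj L i e)
  determined {symbol} {row}    _ {i , _}   e    refl = cong (i ,_) (rowInj L i e)
  determined {col}    {symbol} _ {_ , j}   refl e    = cong (_, j) (colInj L j e)
  determined {symbol} {col}    _ {_ , j}   e    refl = cong (_, j) (colInj L j e)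

  adjacent⇒shared : ∀ v c → Adj L v c → ∃ λ a → coord a c ≡ coord a v
  adjacent⇒shared _ _ (_ , inj₁ e)        = row    , sym e
  adjacent⇒shared _ _ (_ , inj₂ (inj₁ e)) = col    , sym e
  adjacent⇒shared _ _ (_ , inj₂ (inj₂ e)) = symbol , sym e

  shared⇒adjacent : ∀ a {v c} → v ≢ c → coord a c ≡ coord a v → Adj L v c
  shared⇒adjacent row    {_ , _} {_ , _} v≢c e = v≢c , inj₁ (sym e)
  shared⇒adjacent col    {_ , _} {_ , _} v≢c e = v≢c , inj₂ (inj₁ (sym e))
  shared⇒adjacent symbol {_ , _} {_ , _} v≢c e = v≢c , inj₂ (inj₂ (sym e))

  columnOf : Fin n → Fin n → Fin n
  columnOf i t = proj₁ (injective⇒surjective (rowInj L i) t)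

  line : Axis → Fin n → Fin n → Cell n
  line row    t i = t , i
  line col    t i = i , t
  line symbol t i = i , columnOf i t

  coord-line : ∀ a t i → coord a (line a t i) ≡ t
  coord-line row    t i = refl
  coord-line col    t i = refl
  coord-line symbol t i = proj₂ (injective⇒surjective (rowInj L i) t)

  line-injective : ∀ a t → Injective _≡_ _≡_ (line a t)
  line-injective row    t = cong proj₂
  line-injective col    t = cong proj₁
  line-injective symbol t = cong proj₁

  line-spread : ∀ a t b → b ≢ a → Injective _≡_ _≡_ (coord b ∘ line a t)
  line-spread a t b b≢a {i} {j} eb =
    line-injective a t (determined (b≢a ∘ sym) (trans (coord-line a t i) (sym (coord-line a t j))) eb)

module Occupancy {n : ℕ} (L : LatinSquare n) (S : VSubset n) where

  open Axes L

  -- c ∈S S means T (S c); the counting functions of Defs decide it as S c ≡ true.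
  member : ∀ c → Dec (S c ≡ true)
  member c = S c B.≟ true

  T⇒≡ : ∀ {b} → T b → b ≡ true
  T⇒≡ = Equivalence.to T-≡

  ≡⇒T : ∀ {b} → b ≡ true → T b
  ≡⇒T = Equivalence.from T-≡

  χ : ∀ {P : Cell n → Set} → Decidable P → Cell n → ℕ
  χ P? c = ind (member c ×-dec P? c)

  #S : ∀ {P : Cell n → Set} → Decidable P → ℕ
  #S P? = ∑² (χ P?)

  count : Axis → Fin n → ℕ
  count a t = #S (λ c → coord a c ≟ t)

  card-∑ : card S ≡ ∑² (ind ∘ member)
  card-∑ = count-grid member id id

  nbrsIn-∑ : ∀ v → nbrsIn L S v ≡ #S (adj? L v)
  nbrsIn-∑ v = count-grid (λ c → member c ×-dec adj? L v c) id id

  #S-pos : ∀ {P : Cell n → Set} (P? : Decidable P) {c} → c ∈S S → P c → 0 < #S P?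
  #S-pos P? {c} c∈S Pc =
    ∑²-points (χ P?) ([] ∷ []) (ind-pos (member c ×-dec P? c) (T⇒≡ c∈S , Pc) ∷ [])

  exactlyOne⇒#S≡1 : ∀ {P : Cell n → Set} (P? : Decidable P) → ExactlyOne S P → #S P? ≡ 1
  exactlyOne⇒#S≡1 P? (c , (c∈S , Pc) , unique) = trans
    (∑²-point (χ P?) c λ d d≢c →
       ind-no (member d ×-dec P? d) (λ (d∈S , Pd) → d≢c (unique d (≡⇒T d∈S) Pd)))
    (ind-yes (member c ×-dec P? c) (T⇒≡ c∈S , Pc))

  #S≡1⇒exactlyOne : ∀ {P : Cell n → Set} (P? : Decidable P) → #S P? ≡ 1 → ExactlyOne S P
  #S≡1⇒exactlyOne {P = P} P? #≡1 with ∑²-witness (χ P?) (≤-reflexive (sym #≡1))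
  ... | c , pos with ind-pos⁻¹ (member c ×-dec P? c) pos
  ...   | c∈S , Pc = c , (≡⇒T c∈S , Pc) , unique
    where
    unique : ∀ d → d ∈S S → P d → d ≡ c
    unique d d∈S Pd with d ≟² c
    ... | yes d≡c = d≡c
    ... | no  d≢c = contradiction (subst (2 ≤_) #≡1 two) (λ { (s≤s ()) })
      where
      two : 2 ≤ #S P?
      two = ∑²-points (χ P?) (((d≢c ∘ sym) ∷ []) ∷ [] ∷ [])
                      (pos ∷ ind-pos (member d ×-dec P? d) (T⇒≡ d∈S , Pd) ∷ [])

  classes-partition : ∀ {m} (κ : Cell n → Fin m) → ∑[ t < m ] #S (λ c → κ c ≟ t) ≡ ∑² (ind ∘ member)
  classes-partition {m} κ = begin
    ∑[ t < m ] ∑[ i < n ] ∑[ j < n ] χᵗ t (i , j)   ≡⟨ ∑-comm (λ t i → ∑[ j < n ] χᵗ t (i , j)) ⟩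
    ∑[ i < n ] ∑[ t < m ] ∑[ j < n ] χᵗ t (i , j)   ≡⟨ sum-cong-≗ (λ i → ∑-comm (λ t j → χᵗ t (i , j))) ⟩
    ∑² (λ c → ∑[ t < m ] χᵗ t c)                   ≡⟨ ∑²-cong in-one-class ⟩
    ∑² (ind ∘ member)                               ∎
    where
    open ≡-Reasoning
    χᵗ : Fin m → Cell n → ℕ
    χᵗ t = χ (λ c → κ c ≟ t)
    in-one-class : ∀ c → ∑[ t < m ] χᵗ t c ≡ ind (member c)
    in-one-class c = trans
      (∑-point (λ t → χᵗ t c) (κ c) λ t t≢κc → ind-no (member c ×-dec (κ c ≟ t)) (t≢κc ∘ sym ∘ proj₂))
      (ind-×-yes (member c) (κ c ≟ κ c) refl)

  neighbours-bound : ∀ v → nbrsIn L S v ≤ ∑ₐ (λ a → count a (coord a v))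
  neighbours-bound v = begin
    nbrsIn L S v                          ≡⟨ nbrsIn-∑ v ⟩
    ∑² (χ (adj? L v))                     ≤⟨ ∑²-mono adjacent-counted ⟩
    ∑² (λ c → ∑ₐ (λ a → sharing a c))     ≡⟨ ∑²-∑ₐ sharing ⟩
    ∑ₐ (λ a → count a (coord a v))        ∎
    where
    open ≤-Reasoning
    sharing : Axis → Cell n → ℕ
    sharing a = χ (λ d → coord a d ≟ coord a v)
    adjacent-counted : ∀ c → χ (adj? L v) c ≤ ∑ₐ (λ a → sharing a c)
    adjacent-counted c = ind-≤ (member c ×-dec adj? L v c) λ (c∈S , adj) →
      let (a , shared) = adjacent⇒shared v c adj in
      ≤-trans (ind-pos (member c ×-dec (coord a c ≟ coord a v)) (c∈S , shared))
              (∑ₐ-term a (λ b → sharing b c))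

  -- If S is 3-dominating of size n, every class of every axis meets S: were
  -- the line a = t free of S, its n cells would each need 3 neighbours in S,
  -- all lying in the other two axes' classes, whose sizes add up to only 2n.
  every-class-occupied : KDominating 3 L S → card S ≡ n → ∀ a t → 0 < count a t
  every-class-occupied dominating card≡n a t with 0 <? count a t
  ... | yes occupied = occupied
  ... | no  empty    = contradiction (*-cancelˡ-≤ n ⦃ nonZeroIndex t ⦄ 3n≤2n) λ { (s≤s (s≤s ())) }
    where
    count≡0 : count a t ≡ 0
    count≡0 = n≤0⇒n≡0 (≮⇒≥ empty)
    outside : ∀ i → ¬ (line a t i ∈S S)
    outside i i∈S = empty (#S-pos (λ c → coord a c ≟ t) i∈S (coord-line a t i))
    load : Axis → ℕ
    load b = ∑[ i < n ] count b (coord b (line a t i))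
    load-a : load a ≡ 0
    load-a = ∑-zero _ (λ i → trans (cong (count a) (coord-line a t i)) count≡0)
    load-other : ∀ b → b ≢ a → load b ≤ n
    load-other b b≢a = begin
      load b                    ≤⟨ ∑-reindex-≤ (count b) (line-spread a t b b≢a) ⟩
      ∑[ s < n ] count b s      ≡⟨ classes-partition (coord b) ⟩
      ∑² (ind ∘ member)         ≡⟨ card-∑ ⟨
      card S                    ≡⟨ card≡n ⟩
      n                         ∎
      where open ≤-Reasoning
    3n≤2n : n * 3 ≤ n * 2
    3n≤2n = begin
      n * 3                                                ≡⟨ ∑-const n 3 ⟨
      ∑[ i < n ] 3                                         ≤⟨ ∑-mono (λ i → dominating (line a t i) (outside i)) ⟩
      ∑[ i < n ] nbrsIn L S (line a t i)                   ≤⟨ ∑-mono (λ i → neighbours-bound (line a t i)) ⟩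
      ∑[ i < n ] ∑ₐ (λ b → count b (coord b (line a t i))) ≡⟨ ∑-∑ₐ (λ b i → count b (coord b (line a t i))) ⟩
      ∑ₐ load                                              ≤⟨ ∑ₐ-two a load n load-a load-other ⟩
      2 * n                                                ≡⟨ *-comm 2 n ⟩
      n * 2                                                ∎
      where open ≤-Reasoning

  OnePerClass : Set
  OnePerClass = ∀ a t → ExactlyOne S (λ c → coord a c ≡ t)

  onePerClass⇒transversal : OnePerClass → Transversal L S
  onePerClass⇒transversal one = one row , one col , one symbol

  transversal⇒onePerClass : Transversal L S → OnePerClass
  transversal⇒onePerClass (rows , cols , symbols) row    = rows
  transversal⇒onePerClass (rows , cols , symbols) col    = cols
  transversal⇒onePerClass (rows , cols , symbols) symbol = symbols

  -- (i) ⇒ (iii): the n class sizes of an axis are positive and sum to n.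
  dominating⇒transversal : KDominating 3 L S → card S ≡ n → Transversal L S
  dominating⇒transversal dominating card≡n = onePerClass⇒transversal λ a t →
    #S≡1⇒exactlyOne (λ c → coord a c ≟ t)
      (≤-antisym (∑-tight (count a) (occupied a) (≤-reflexive (classes-sum a)) t) (occupied a t))
    where
    occupied : ∀ a t → 0 < count a t
    occupied = every-class-occupied dominating card≡n
    classes-sum : ∀ a → ∑[ t < n ] count a t ≡ n
    classes-sum a = trans (classes-partition (coord a)) (trans (sym card-∑) card≡n)

  module FromTransversal (transversal : Transversal L S) where

    one : OnePerClass
    one = transversal⇒onePerClass transversal

    representative : Axis → Fin n → Cell n
    representative a t = proj₁ (one a t)

    representative∈S : ∀ a t → representative a t ∈S S
    representative∈S a t = proj₁ (proj₁ (proj₂ (one a t)))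

    coord-representative : ∀ a t → coord a (representative a t) ≡ t
    coord-representative a t = proj₂ (proj₁ (proj₂ (one a t)))

    is-representative : ∀ a {c} → c ∈S S → c ≡ representative a (coord a c)
    is-representative a {c} c∈S = proj₂ (proj₂ (one a (coord a c))) c c∈S refl

    -- Two cells of S sharing a coordinate represent the same class, hence coincide.
    independent : Independent L S
    independent u v u∈S v∈S adj =
      let (a , shared) = adjacent⇒shared u v adj in
      proj₁ adj (begin
        u                            ≡⟨ is-representative a u∈S ⟩
        representative a (coord a u) ≡⟨ cong (representative a) shared ⟨
        representative a (coord a v) ≡⟨ is-representative a v∈S ⟨
        v                            ∎)
      where open ≡-Reasoning

    -- S has one cell in each of the n rows.
    size : card S ≡ n
    size = begin
      card S                  ≡⟨ card-∑ ⟩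
      ∑² (ind ∘ member)       ≡⟨ classes-partition (coord row) ⟨
      ∑[ t < n ] count row t  ≡⟨ sum-cong-≗ (λ t → exactlyOne⇒#S≡1 (λ c → coord row c ≟ t) (one row t)) ⟩
      ∑[ t < n ] 1            ≡⟨ ∑-const n 1 ⟩
      n * 1                   ≡⟨ *-identityʳ n ⟩
      n                       ∎
      where open ≡-Reasoning

    -- A cell v outside S is adjacent to the representatives of its row, its
    -- column and its symbol, and these are distinct: a cell sharing two
    -- coordinates with v would be v itself.
    dominating : KDominating 3 L S
    dominating v v∉S = begin
      3                     ≤⟨ ∑²-points (χ (adj? L v)) distinct-reps
                                 (adjacent row ∷ adjacent col ∷ adjacent symbol ∷ []) ⟩
      ∑² (χ (adj? L v))     ≡⟨ nbrsIn-∑ v ⟨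
      nbrsIn L S v          ∎
      where
      open ≤-Reasoning
      rep : Axis → Cell n
      rep a = representative a (coord a v)
      v≢rep : ∀ a → v ≢ rep a
      v≢rep a v≡rep = v∉S (subst (_∈S S) (sym v≡rep) (representative∈S a _))
      distinct : ∀ {a b} → a ≢ b → rep a ≢ rep b
      distinct {a} {b} a≢b ra≡rb = v≢rep a (sym (determined a≢b
        (coord-representative a _)
        (trans (cong (coord b) ra≡rb) (coord-representative b _))))
      distinct-reps : Unique (rep row ∷ rep col ∷ rep symbol ∷ [])
      distinct-reps = (distinct {row} {col} (λ ()) ∷ distinct {row} {symbol} (λ ()) ∷ [])
                    ∷ (distinct {col} {symbol} (λ ()) ∷ []) ∷ [] ∷ []
      adjacent : ∀ a → 0 < χ (adj? L v) (rep a)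
      adjacent a = ind-pos (member (rep a) ×-dec adj? L v (rep a))
        (T⇒≡ (representative∈S a _) , shared⇒adjacent a (v≢rep a) (coord-representative a _))

theorem2p1 : (n : ℕ) (L : LatinSquare n) (S : VSubset n) →
    ((KDominating 3 L S × card S ≡ n) ⇔ (IndepDominating13 L S × card S ≡ n)) ×
    ((IndepDominating13 L S × card S ≡ n) ⇔ Transversal L S)
theorem2p1 n L S =
    mk⇔ (λ (dom , |S|≡n) → (dom , independent (dominating⇒transversal dom |S|≡n)) , |S|≡n)
        (λ ((dom , _) , |S|≡n) → dom , |S|≡n)
  , mk⇔ (λ ((dom , _) , |S|≡n) → dominating⇒transversal dom |S|≡n)
        (λ tr → (dominating tr , independent tr) , size tr)
  where
  open Occupancy L S
  open FromTransversal
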